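{- Let $L_{\mathcal{P}}=\{u\in\{0,1\}^+\mid u=u^R\}$ be the set of nonempty binary palindromes. Then every graph is $L_{\mathcal{P}}$-representable, i.e., $\mathcal{G}_{L_{\mathcal{P}}}$ is the class of all graphs.
   Context: All graphs are finite, simple, undirected, with nonempty vertex sets, and graph classes are considered up to isomorphism. $u^R$ denotes the reversal of $u$, $\lambda$ the empty word. For an alphabet $V$ and distinct $u,v\in V$, $h_{u,v}:V^*\to\{0,1\}^*$ is the monoid morphism with $u\mapsto 0$, $v\mapsto 1$ and $x\mapsto\lambda$ for all other letters $x$. For a language $L\subseteq\{0,1\}^*$ closed under exchanging 0 and 1 and a nonempty word $w$ whose set of occurring letters is $V$, $G(L,w)$ is the graph with vertex set $V$ in which distinct $u,v$ are adjacent iff $h_{u,v}(w)\in L$. A graph is $L$-representable if it is isomorphic to some $G(L,w)$; $\mathcal{G}_L$ is the class of $L$-representable graphs. -}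

module Defs where

open import Data.Nat using (ℕ; NonZero)
open import Data.Fin using (Fin; _≟_)
open import Data.Bool using (Bool; true; false)
open import Data.List using (List; []; _∷_; reverse)
open import Data.List.Membership.Propositional using (_∈_)
open import Data.Product using (Σ; ∃; _×_)
open import Relation.Binary.PropositionalEquality using (_≡_)
open import Relation.Nullary using (¬_; yes; no)
open import Function using (Injective)
open import Function.Bundles using (_⇔_)

record Graph : Set where
  field
    n      : ℕ
    .{{nonempty}} : NonZero n
    adj    : Fin n → Fin n → Bool
    sym    : ∀ u v → adj u v ≡ adj v u
    irrefl : ∀ u → adj u u ≡ false

-- Binary words: false = 0, true = 1.
BinWord : Set
BinWord = List Bool

h : ∀ {m} → Fin m → Fin m → List (Fin m) → BinWord
h u v [] = []
h u v (x ∷ w) with x ≟ u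
... | yes _ = false ∷ h u v w
... | no _ with x ≟ v
...   | yes _ = true ∷ h u v w
...   | no _  = h u v w

-- L-representability: G is isomorphic to G(L,w) for some nonempty word w
-- over a finite alphabet Fin m.  The isomorphism is an injection
-- f : Fin n → Fin m whose image is exactly the set of letters occurring in w,
-- and which maps adjacency in G to adjacency in G(L,w).
Representable : (BinWord → Set) → Graph → Set
Representable L G =
  Σ ℕ λ m → Σ (List (Fin m)) λ w → Σ (Fin n → Fin m) λ f →
      ¬ (w ≡ [])
    × Injective _≡_ _≡_ f
    × (∀ u → f u ∈ w)
    × (∀ {x} → x ∈ w → ∃ λ u → f u ≡ x)
    × (∀ u v → ¬ (u ≡ v) → (adj u v ≡ true) ⇔ L (h (f u) (f v) w))
  where open Graph G

PalindromeLang : BinWord → Set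
PalindromeLang u = ¬ (u ≡ []) × (reverse u ≡ u)

{-# OPTIONS --safe #-}
-- Let σ list all vertices. For every ordered pair (u, v) open a frame with uv and close it with
-- vu if u ~ v and with uv otherwise; the word nests the core σ σᴿ, which makes every vertex occur,
-- inside all these frames. Under the projection h_{a,b}, opening and closing of a frame have equal
-- length, so the projected word is a palindrome iff every projected closing mirrors the projected
-- opening (the projected core is a palindrome). Letters project to words of length at most one, so
-- vu always mirrors uv, and uv mirrors itself unless {u, v} = {a, b} with u ≠ v: the only frames
-- that can break the palindrome are those of (a, b) and (b, a), and they do so exactly when ab is
-- a non-edge.
module Submission where

open import Defs
open import Data.Nat using (ℕ; >-nonZero⁻¹)
open import Data.Nat.Properties using (suc-injective)
open import Data.Fin using (Fin; _≟_; fromℕ<)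
open import Data.Bool using (true; false; if_then_else_)
open import Data.List using (List; []; _∷_; [_]; reverse; _++_; length; allFin; cartesianProduct)
open import Data.List.Properties
  using (reverse-++; reverse-involutive; length-reverse; unfold-reverse; ++-assoc; ++-cancelʳ;
         ++-conicalʳ; ∷-injectiveˡ; ∷-injectiveʳ)
open import Data.List.Membership.Propositional using (_∈_)
open import Data.List.Membership.Propositional.Properties
  using (∈-++⁺ˡ; ∈-++⁺ʳ; ∈-allFin; ∈-cartesianProduct⁺)
open import Data.List.Relation.Unary.All as All using (All; []; _∷_)
open import Data.List.Relation.Unary.Any using (here; there)
open import Data.Product using (_×_; _,_; proj₁; proj₂; map₁)
open import Function using (id; _∘_)
open import Function.Bundles using (_⇔_; mk⇔; Equivalence)
open import Relation.Binary.PropositionalEquality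
  using (_≡_; _≢_; refl; sym; trans; cong; cong₂; subst; module ≡-Reasoning)
open import Relation.Nullary using (¬_; yes; no; contradiction)

open Equivalence using (to; from)
open ≡-Reasoning

Palindrome : {A : Set} → List A → Set
Palindrome xs = reverse xs ≡ xs

module _ {A : Set} where

  ++-injective : (ws xs : List A) {ys zs : List A} → length ws ≡ length xs →
                 ws ++ ys ≡ xs ++ zs → ws ≡ xs × ys ≡ zs
  ++-injective []       []       _  eq = refl , eq
  ++-injective (w ∷ ws) (x ∷ xs) |eq| eq
    with ++-injective ws xs (suc-injective |eq|) (∷-injectiveʳ eq)
  ... | refl , ys≡zs = cong (_∷ ws) (∷-injectiveˡ eq) , ys≡zs

  mirror-palindrome : (xs : List A) → Palindrome (xs ++ reverse xs)
  mirror-palindrome xs = begin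
    reverse (xs ++ reverse xs)          ≡⟨ reverse-++ xs (reverse xs) ⟩
    reverse (reverse xs) ++ reverse xs  ≡⟨ cong (_++ reverse xs) (reverse-involutive xs) ⟩
    xs ++ reverse xs                    ∎

  palindrome-sandwich : (xs ys zs : List A) → length xs ≡ length zs →
                        Palindrome (xs ++ ys ++ zs) ⇔ (zs ≡ reverse xs × Palindrome ys)
  palindrome-sandwich xs ys zs |xs|≡|zs| = mk⇔ outer-mirrored sandwich-palindrome
    where
    reverse-sandwich : reverse (xs ++ ys ++ zs) ≡ reverse zs ++ reverse ys ++ reverse xs
    reverse-sandwich = begin
      reverse (xs ++ ys ++ zs)                 ≡⟨ reverse-++ xs (ys ++ zs) ⟩
      reverse (ys ++ zs) ++ reverse xs         ≡⟨ cong (_++ reverse xs) (reverse-++ ys zs) ⟩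
      (reverse zs ++ reverse ys) ++ reverse xs ≡⟨ ++-assoc (reverse zs) (reverse ys) (reverse xs) ⟩
      reverse zs ++ reverse ys ++ reverse xs   ∎

    outer-mirrored : Palindrome (xs ++ ys ++ zs) → zs ≡ reverse xs × Palindrome ys
    outer-mirrored pal
      with ++-injective (reverse zs) xs (trans (length-reverse zs) (sym |xs|≡|zs|))
                        (trans (sym reverse-sandwich) pal)
    ... | refl , middle = sym (reverse-involutive zs) , ++-cancelʳ (reverse xs) (reverse ys) ys middle′
      where
      middle′ : reverse ys ++ reverse xs ≡ ys ++ reverse xs
      middle′ = trans middle (cong (ys ++_) (sym (reverse-involutive zs)))

    sandwich-palindrome : zs ≡ reverse xs × Palindrome ys → Palindrome (xs ++ ys ++ zs)
    sandwich-palindrome (refl , pal) = begin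
      reverse (xs ++ ys ++ reverse xs)
        ≡⟨ reverse-sandwich ⟩
      reverse (reverse xs) ++ reverse ys ++ reverse xs
        ≡⟨ cong₂ (λ l m → l ++ m ++ reverse xs) (reverse-involutive xs) pal ⟩
      xs ++ ys ++ reverse xs ∎

module _ {A X : Set} (opening closing : A → List X) where

  wrap : List A → List X → List X
  wrap []       core = core
  wrap (p ∷ ps) core = opening p ++ wrap ps core ++ closing p

  Mirrored : A → Set
  Mirrored p = closing p ≡ reverse (opening p)

  palindrome-wrap : (∀ p → length (opening p) ≡ length (closing p)) → ∀ ps core →
                    Palindrome (wrap ps core) ⇔ (All Mirrored ps × Palindrome core)
  palindrome-wrap balanced []       core = mk⇔ ([] ,_) proj₂
  palindrome-wrap balanced (p ∷ ps) core = mk⇔ peel enclose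
    where
    sandwich = palindrome-sandwich (opening p) (wrap ps core) (closing p) (balanced p)
    inner = palindrome-wrap balanced ps core

    peel : Palindrome (wrap (p ∷ ps) core) → All Mirrored (p ∷ ps) × Palindrome core
    peel pal with to sandwich pal
    ... | mirrored , inner-pal = map₁ (mirrored ∷_) (to inner inner-pal)

    enclose : All Mirrored (p ∷ ps) × Palindrome core → Palindrome (wrap (p ∷ ps) core)
    enclose (mirrored ∷ all-mirrored , core-pal) =
      from sandwich (mirrored , from inner (all-mirrored , core-pal))

  ∈-wrap⁺ : ∀ {x} ps {core} → x ∈ core → x ∈ wrap ps core
  ∈-wrap⁺ []       x∈core = x∈core
  ∈-wrap⁺ (p ∷ ps) x∈core = ∈-++⁺ʳ (opening p) (∈-++⁺ˡ (∈-wrap⁺ ps x∈core))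

data LetterImage {m : ℕ} : (a b x : Fin m) → BinWord → Set where
  first  : ∀ {a b}   → LetterImage a b a [ false ]
  second : ∀ {a b}   → LetterImage a b b [ true ]
  erased : ∀ {a b x} → LetterImage a b x []

letterImage : ∀ {m} (a b x : Fin m) → LetterImage a b x (h a b [ x ])
letterImage a b x with x ≟ a
... | yes refl = first
... | no _ with x ≟ b
...   | yes refl = second
...   | no _     = erased

module _ {m : ℕ} (a b : Fin m) where

  h-++ : ∀ xs ys → h a b (xs ++ ys) ≡ h a b xs ++ h a b ys
  h-++ []       ys = refl
  h-++ (x ∷ xs) ys with x ≟ a
  ... | yes _ = cong (false ∷_) (h-++ xs ys)
  ... | no _ with x ≟ b
  ...   | yes _ = cong (true ∷_) (h-++ xs ys)
  ...   | no _  = h-++ xs ys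

  h-letter-palindrome : ∀ x → Palindrome (h a b [ x ])
  h-letter-palindrome x with h a b [ x ] | letterImage a b x
  ... | _ | first  = refl
  ... | _ | second = refl
  ... | _ | erased = refl

  h-reverse : ∀ xs → h a b (reverse xs) ≡ reverse (h a b xs)
  h-reverse []       = refl
  h-reverse (x ∷ xs) = begin
    h a b (reverse (x ∷ xs))                    ≡⟨ cong (h a b) (unfold-reverse x xs) ⟩
    h a b (reverse xs ++ [ x ])                 ≡⟨ h-++ (reverse xs) [ x ] ⟩
    h a b (reverse xs) ++ h a b [ x ]           ≡⟨ cong₂ _++_ (h-reverse xs) (sym (h-letter-palindrome x)) ⟩
    reverse (h a b xs) ++ reverse (h a b [ x ]) ≡⟨ reverse-++ (h a b [ x ]) (h a b xs) ⟨
    reverse (h a b [ x ] ++ h a b xs)           ≡⟨ cong reverse (h-++ [ x ] xs) ⟨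
    reverse (h a b (x ∷ xs))                    ∎

  h-palindrome : ∀ {xs} → Palindrome xs → Palindrome (h a b xs)
  h-palindrome {xs} pal = trans (sym (h-reverse xs)) (cong (h a b) pal)

  h-wrap : ∀ {A} (opening closing : A → List (Fin m)) ps core →
           h a b (wrap opening closing ps core) ≡ wrap (h a b ∘ opening) (h a b ∘ closing) ps (h a b core)
  h-wrap opening closing []       core = refl
  h-wrap opening closing (p ∷ ps) core = begin
    h a b (opening p ++ wrap opening closing ps core ++ closing p)
      ≡⟨ h-++ (opening p) _ ⟩
    h a b (opening p) ++ h a b (wrap opening closing ps core ++ closing p)
      ≡⟨ cong (h a b (opening p) ++_) (h-++ (wrap opening closing ps core) (closing p)) ⟩
    h a b (opening p) ++ h a b (wrap opening closing ps core) ++ h a b (closing p)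
      ≡⟨ cong (λ inner → h a b (opening p) ++ inner ++ h a b (closing p)) (h-wrap opening closing ps core) ⟩
    h a b (opening p) ++ wrap (h a b ∘ opening) (h a b ∘ closing) ps (h a b core) ++ h a b (closing p) ∎

  h-head : ∀ xs → h a b (a ∷ xs) ≡ false ∷ h a b xs
  h-head xs with a ≟ a
  ... | yes _   = refl
  ... | no a≢a = contradiction refl a≢a

  h-nonempty : ∀ {xs} → a ∈ xs → h a b xs ≢ []
  h-nonempty {a ∷ xs} (here refl) rewrite h-head xs = λ ()
  h-nonempty {x ∷ xs} (there a∈xs) empty =
    h-nonempty a∈xs (++-conicalʳ (h a b [ x ]) (h a b xs) (trans (sym (h-++ [ x ] xs)) empty))

  h-ab : a ≢ b → h a b (a ∷ b ∷ []) ≡ false ∷ true ∷ []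
  h-ab a≢b rewrite h-head (b ∷ []) with b ≟ a
  ... | yes b≡a = contradiction (sym b≡a) a≢b
  ... | no _ with b ≟ b
  ...   | yes _   = refl
  ...   | no b≢b = contradiction refl b≢b

  h-pair-palindrome : ∀ u v → ¬ (u ≡ a × v ≡ b) → ¬ (u ≡ b × v ≡ a) → Palindrome (h a b (u ∷ v ∷ []))
  h-pair-palindrome u v not-ab not-ba rewrite h-++ [ u ] [ v ]
    with h a b [ u ] | letterImage a b u | h a b [ v ] | letterImage a b v
  ... | _ | first  | _ | first  = refl
  ... | _ | first  | _ | second = contradiction (refl , refl) not-ab
  ... | _ | first  | _ | erased = refl
  ... | _ | second | _ | first  = contradiction (refl , refl) not-ba
  ... | _ | second | _ | second = refl
  ... | _ | second | _ | erased = refl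
  ... | _ | erased | _ | first  = refl
  ... | _ | erased | _ | second = refl
  ... | _ | erased | _ | erased = refl

module _ (G : Graph) where
  open Graph G using (n; adj) renaming (sym to adj-sym)

  opening closing : Fin n × Fin n → List (Fin n)
  opening (u , v) = u ∷ v ∷ []
  closing (u , v) = if adj u v then v ∷ u ∷ [] else u ∷ v ∷ []

  vertices : List (Fin n)
  vertices = allFin n ++ reverse (allFin n)

  pairs : List (Fin n × Fin n)
  pairs = cartesianProduct (allFin n) (allFin n)

  ∈-pairs : ∀ u v → (u , v) ∈ pairs
  ∈-pairs u v = ∈-cartesianProduct⁺ (∈-allFin u) (∈-allFin v)

  word : List (Fin n)
  word = wrap opening closing pairs vertices

  ∈-word : ∀ x → x ∈ word
  ∈-word x = ∈-wrap⁺ opening closing pairs (∈-++⁺ˡ (∈-allFin x))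

  word≢[] : word ≢ []
  word≢[] empty with subst (fromℕ< (>-nonZero⁻¹ n) ∈_) empty (∈-word _)
  ... | ()

  module _ (a b : Fin n) where

    h-balanced : ∀ p → length (h a b (opening p)) ≡ length (h a b (closing p))
    h-balanced (u , v) with adj u v
    ... | true  = sym (trans (cong length (h-reverse a b (u ∷ v ∷ []))) (length-reverse (h a b (u ∷ v ∷ []))))
    ... | false = refl

    HMirrored : Fin n × Fin n → Set
    HMirrored = Mirrored (h a b ∘ opening) (h a b ∘ closing)

    h-word-palindrome : Palindrome (h a b word) ⇔ All HMirrored pairs
    h-word-palindrome rewrite h-wrap a b opening closing pairs vertices =
      mk⇔ (proj₁ ∘ to wrap-palindrome) (λ mirrored → from wrap-palindrome (mirrored , vertices-palindrome))
      where
      wrap-palindrome = palindrome-wrap (h a b ∘ opening) (h a b ∘ closing) h-balanced pairs (h a b vertices)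
      vertices-palindrome = h-palindrome a b (mirror-palindrome (allFin n))

    adjacent⇒mirrored : adj a b ≡ true → ∀ p → HMirrored p
    adjacent⇒mirrored ab (u , v) with adj u v in uv
    ... | true  = h-reverse a b (u ∷ v ∷ [])
    ... | false = sym (h-pair-palindrome a b u v not-ab not-ba)
      where
      not-ab : ¬ (u ≡ a × v ≡ b)
      not-ab (refl , refl) = contradiction (trans (sym ab) uv) λ ()

      not-ba : ¬ (u ≡ b × v ≡ a)
      not-ba (refl , refl) = contradiction (trans (sym ab) (trans (adj-sym a b) uv)) λ ()

    mirrored⇒adjacent : a ≢ b → HMirrored (a , b) → adj a b ≡ true
    mirrored⇒adjacent a≢b mirrored with adj a b
    ... | true  = refl
    ... | false with trans (sym (h-ab a b a≢b)) (trans mirrored (cong reverse (h-ab a b a≢b)))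
    ...   | ()

  adjacent⇔palindrome : ∀ u v → u ≢ v → (adj u v ≡ true) ⇔ PalindromeLang (h u v word)
  adjacent⇔palindrome u v u≢v = mk⇔ edge-palindrome palindrome-edge
    where
    edge-palindrome : adj u v ≡ true → PalindromeLang (h u v word)
    edge-palindrome uv =
      h-nonempty u v (∈-word u) , from (h-word-palindrome u v) (All.universal (adjacent⇒mirrored u v uv) pairs)

    palindrome-edge : PalindromeLang (h u v word) → adj u v ≡ true
    palindrome-edge (_ , pal) =
      mirrored⇒adjacent u v u≢v (All.lookup (to (h-word-palindrome u v) pal) (∈-pairs u v))

mainTheorem9 : (G : Graph) → Representable PalindromeLang G
mainTheorem9 G =
  n , word G , id , word≢[] G , id , ∈-word G , (λ {x} _ → x , refl) , adjacent⇔palindrome G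
  where open Graph G using (n)
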